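{- Let $\Delta_0$ be the smallest integer such that every digraph $D$ without digons with $\lceil \tilde{\Delta}(D) \rceil = \Delta_0$ satisfies $\chi(D) \leq \Delta_0 - 1$. Then every digraph $D$ without digons with $\lceil \tilde{\Delta}(D) \rceil \geq \Delta_0$ satisfies $\chi(D) \leq \lceil \tilde{\Delta}(D) \rceil - 1$.
   Context: All digraphs are finite and simple (no loops, no two arcs with the same initial and the same terminal vertex). A digon is a pair of arcs $xy$, $yx$. $\tilde{\Delta}(D) = \max\{\sqrt{d^{+}(v)d^{ - }(v)} : v \in V(D)\}$, where $d^{+}, d^{ - }$ are out- and in-degree. A set $A \subseteq V(D)$ is acyclic if $D[A]$ has no directed cycle; $\chi(D)$ is the least $k$ such that $V(D)$ can be partitioned into $k$ acyclic sets. -}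

module Defs where

open import Data.Nat using (ℕ; zero; suc; _*_; _≤_; _<_)
open import Data.Bool using (Bool; true; false; if_then_else_)
open import Data.Fin using (Fin; inject₁; fromℕ) renaming (zero to fzero; suc to fsuc)
open import Data.List using (map; allFin)
open import Data.Nat.ListAction using (sum)
open import Data.Product using (Σ; _×_; ∃)
open import Relation.Binary.PropositionalEquality using (_≡_)
open import Relation.Nullary using (¬_)
open import Function.Definitions using (Injective)

-- A finite simple digraph on vertex set Fin n: adjacency is a Bool relation
-- (so at most one arc u → v), with no loops.
record Digraph : Set where
  field
    n       : ℕ
    arc     : Fin n → Fin n → Bool
    noLoops : ∀ v → arc v v ≡ false

open Digraph public

NoDigons : Digraph → Set
NoDigons D = ∀ u v → arc D u v ≡ true → arc D v u ≡ false

outdeg : (D : Digraph) → Fin (n D) → ℕ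
outdeg D v = sum (map (λ w → if arc D v w then 1 else 0) (allFin (n D)))

indeg : (D : Digraph) → Fin (n D) → ℕ
indeg D v = sum (map (λ w → if arc D w v then 1 else 0) (allFin (n D)))

-- k = ⌈ Δ̃(D) ⌉ = ⌈ max_v sqrt(d⁺(v) d⁻(v)) ⌉, i.e. k is the least natural
-- number with sqrt(d⁺(v)d⁻(v)) ≤ k for all v, i.e. d⁺(v)d⁻(v) ≤ k*k for all v.
CeilMaxDeg : Digraph → ℕ → Set
CeilMaxDeg D k =
  (∀ v → outdeg D v * indeg D v ≤ k * k) ×
  (∀ j → (∀ v → outdeg D v * indeg D v ≤ j * j) → k ≤ j)

-- A directed cycle of D all of whose vertices lie in the set A:
-- distinct vertices f 0, …, f (l+1) (length ≥ 2) with arcs f i → f (i+1)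
-- and f (l+1) → f 0.
CycleIn : (D : Digraph) → (Fin (n D) → Set) → Set
CycleIn D A =
  Σ ℕ λ l → Σ (Fin (suc (suc l)) → Fin (n D)) λ f →
    Injective _≡_ _≡_ f ×
    (∀ i → A (f i)) ×
    (∀ (i : Fin (suc l)) → arc D (f (inject₁ i)) (f (fsuc i)) ≡ true) ×
    (arc D (f (fromℕ (suc l))) (f fzero) ≡ true)

Acyclic : (D : Digraph) → (Fin (n D) → Set) → Set
Acyclic D A = ¬ CycleIn D A

AcyclicColouring : (D : Digraph) → ℕ → Set
AcyclicColouring D k =
  Σ (Fin (n D) → Fin k) λ c → ∀ (i : Fin k) → Acyclic D (λ v → c v ≡ i)

IsDichromatic : Digraph → ℕ → Set
IsDichromatic D k =
  AcyclicColouring D k × (∀ j → AcyclicColouring D j → k ≤ j)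

-- The property defining Δ₀: every digon-free D with ⌈Δ̃(D)⌉ = d has χ(D) ≤ d - 1.
GoodBound : ℕ → Set
GoodBound d = ∀ (D : Digraph) → NoDigons D → CeilMaxDeg D d →
  ∀ χ → IsDichromatic D χ → suc χ ≤ d

-- GoodBound is upward closed.  Given D
-- with ⌈Δ̃(D)⌉ = r + 1, take a maximal acyclic set S.  Each vertex v ∉ S lies on
-- a cycle of D[S ∪ {v}], so it has an out- and an in-neighbour in S; deleting
-- the arcs at S lowers both degrees of v, and (a+1)(b+1) ≤ (r+1)² forces
-- ab ≤ r² by AM-GM.  A disjoint star with r in- and r out-leaves makes
-- ⌈Δ̃⌉ exactly r, so by GoodBound r the digraph without the arcs at S has an
-- acyclic colouring with r - 1 colours, and S is one more colour class.
module Submission where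

open import Defs
open import Level using (0ℓ)
open import Data.Bool using (Bool; true; false; T; not; _∧_; _∨_; if_then_else_)
open import Data.Bool.Properties using (T-∨)
open import Data.Empty using (⊥-elim)
open import Data.Fin using (Fin; zero; suc; inject₁; fromℕ; splitAt; _↑ˡ_; _↑ʳ_; _≟_)
open import Data.Fin.Properties
  using (0≢1+n; any?; splitAt-↑ˡ; splitAt-↑ʳ; ↑ˡ-injective; suc-injective)
open import Data.List using (List; []; _∷_; map; allFin)
open import Data.List.Properties using (map-cong; map-tabulate)
open import Data.List.Membership.Propositional using (_∈_)
open import Data.List.Membership.Propositional.Properties using (∈-allFin)
open import Data.List.Relation.Unary.Any using (here; there)
open import Data.Nat
  using (ℕ; zero; suc; _+_; _*_; _≤_; _<_; _≤′_; ≤′-refl; ≤′-step; z≤n; s≤s; s<s; _≤?_)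
open import Data.Nat.Induction using (<-rec)
open import Data.Nat.ListAction using (sum)
open import Data.Nat.Properties
  using (≤-refl; ≤-reflexive; ≤-trans; ≤-total; ≮⇒≥; ≰⇒>; <⇒≱; ≤⇒≤′;
         m≤m+n; m≤n⇒∃[o]m+o≡n;
         +-comm; +-assoc; +-identityʳ; *-comm; *-zeroʳ; +-mono-≤; +-mono-<; +-mono-≤-<;
         *-mono-≤; *-mono-<; *-monoʳ-<; module ≤-Reasoning)
open import Data.Nat.Tactic.RingSolver using (solve-∀)
open import Data.Product using (Σ; ∃; _×_; _,_; proj₁; proj₂)
open import Data.Sum using (_⊎_; inj₁; inj₂; [_,_]′; map₁; swap)
open import Effect.Monad using (RawMonad)
open import Function using (_∘_; id; const; Equivalence)
open import Function.Definitions using (Injective)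
open import Relation.Binary.PropositionalEquality
open import Relation.Nullary using (¬_; yes; no)
open import Relation.Nullary.Decidable
  using (decidable-stable; ¬¬-excluded-middle; T?; toWitness; fromWitness; ⌊_⌋)
open import Relation.Nullary.Negation using (¬¬-Monad)
open import Relation.Unary using (Pred; _⊆_; _∪_; ｛_｝)

open RawMonad (¬¬-Monad {a = 0ℓ})

m*m≤n*n⇒m≤n : ∀ {m n} → m * m ≤ n * n → m ≤ n
m*m≤n*n⇒m≤n h = ≮⇒≥ λ n<m → <⇒≱ (*-mono-< n<m n<m) h

m*m<n*n⇒m<n : ∀ {m n} → m * m < n * n → m < n
m*m<n*n⇒m<n h = ≰⇒> λ n≤m → <⇒≱ h (*-mono-≤ n≤m n≤m)

m≤n⇒4*m*n≤[m+n]*[m+n] : ∀ {m n} → m ≤ n → 4 * (m * n) ≤ (m + n) * (m + n)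
m≤n⇒4*m*n≤[m+n]*[m+n] {m} m≤n with (d , refl) ← m≤n⇒∃[o]m+o≡n m≤n =
  subst (4 * (m * (m + d)) ≤_) (square-of-sum m d) (m≤m+n _ (d * d))
  where
  square-of-sum : ∀ m d → 4 * (m * (m + d)) + d * d ≡ (m + (m + d)) * (m + (m + d))
  square-of-sum = solve-∀

4*m*n≤[m+n]*[m+n] : ∀ m n → 4 * (m * n) ≤ (m + n) * (m + n)
4*m*n≤[m+n]*[m+n] m n with ≤-total m n
... | inj₁ m≤n = m≤n⇒4*m*n≤[m+n]*[m+n] m≤n
... | inj₂ n≤m = subst₂ _≤_ (cong (4 *_) (*-comm n m)) (cong (λ k → k * k) (+-comm n m))
                       (m≤n⇒4*m*n≤[m+n]*[m+n] n≤m)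

r*r<m*n⇒r+r<m+n : ∀ m n r → r * r < m * n → r + r < m + n
r*r<m*n⇒r+r<m+n m n r h = m*m<n*n⇒m<n (begin-strict
  (r + r) * (r + r)  ≡⟨ double-square r ⟩
  4 * (r * r)        <⟨ *-monoʳ-< 4 h ⟩
  4 * (m * n)        ≤⟨ 4*m*n≤[m+n]*[m+n] m n ⟩
  (m + n) * (m + n)  ∎)
  where
  open ≤-Reasoning
  double-square : ∀ r → (r + r) * (r + r) ≡ 4 * (r * r)
  double-square = solve-∀

[1+m]*[1+n]≤[1+r]*[1+r]⇒m*n≤r*r : ∀ m n r → suc m * suc n ≤ suc r * suc r → m * n ≤ r * r
[1+m]*[1+n]≤[1+r]*[1+r]⇒m*n≤r*r m n r h = ≮⇒≥ λ r*r<m*n → <⇒≱ (grows r*r<m*n) h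
  where
  open ≤-Reasoning
  expand : ∀ m n → suc m * suc n ≡ suc (m * n + (m + n))
  expand = solve-∀
  grows : r * r < m * n → suc r * suc r < suc m * suc n
  grows lt = begin-strict
    suc r * suc r            ≡⟨ expand r r ⟩
    suc (r * r + (r + r))    <⟨ s<s (+-mono-< lt (r*r<m*n⇒r+r<m+n m n r lt)) ⟩
    suc (m * n + (m + n))    ≡⟨ expand m n ⟨
    suc m * suc n            ∎

indicator : Bool → ℕ
indicator b = if b then 1 else 0

-- outdeg D v and indeg D v are definitionally count (arc D v) and count (λ w → arc D w v).
count : ∀ {m} → (Fin m → Bool) → ℕ
count {m} p = sum (map (indicator ∘ p) (allFin m))

count-suc : ∀ {m} (p : Fin (suc m) → Bool) → count p ≡ indicator (p zero) + count (p ∘ suc)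
count-suc p = cong (λ xs → indicator (p zero) + sum xs)
  (trans (map-tabulate suc (indicator ∘ p)) (sym (map-tabulate id (indicator ∘ p ∘ suc))))

count-cong : ∀ {m} {p q : Fin m → Bool} → (∀ i → p i ≡ q i) → count p ≡ count q
count-cong {m} p≗q = cong sum (map-cong (cong indicator ∘ p≗q) (allFin m))

count-false : ∀ {m} → count {m} (const false) ≡ 0
count-false {zero}  = refl
count-false {suc m} = trans (count-suc {m} (const false)) (count-false {m})

count-true : ∀ {m} → count {m} (const true) ≡ m
count-true {zero}  = refl
count-true {suc m} = trans (count-suc {m} (const true)) (cong suc (count-true {m}))

indicator-mono : ∀ {b c} → (b ≡ true → c ≡ true) → indicator b ≤ indicator c
indicator-mono {false} _   = z≤n
indicator-mono {true}  b⇒c rewrite b⇒c refl = ≤-refl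

count-mono-≤ : ∀ {m} {p q : Fin m → Bool} → (∀ i → p i ≡ true → q i ≡ true) →
  count p ≤ count q
count-mono-≤ {zero}          _   = z≤n
count-mono-≤ {suc m} {p} {q} p⇒q rewrite count-suc p | count-suc q =
  +-mono-≤ (indicator-mono (p⇒q zero)) (count-mono-≤ (p⇒q ∘ suc))

count-mono-< : ∀ {m} {p q : Fin m → Bool} → (∀ i → p i ≡ true → q i ≡ true) →
  ∀ {j} → p j ≡ false → q j ≡ true → count p < count q
count-mono-< {suc m} {p} {q} p⇒q {zero} pj qj rewrite count-suc p | count-suc q | pj | qj =
  s≤s (count-mono-≤ (p⇒q ∘ suc))
count-mono-< {suc m} {p} {q} p⇒q {suc j} pj qj rewrite count-suc p | count-suc q =
  +-mono-≤-< (indicator-mono (p⇒q zero)) (count-mono-< (p⇒q ∘ suc) pj qj)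

count-splitAt : ∀ m {n} (p : Fin m ⊎ Fin n → Bool) →
  count (p ∘ splitAt m) ≡ count (p ∘ inj₁) + count (p ∘ inj₂)
count-splitAt zero    p = refl
count-splitAt (suc m) p = begin
  count (p ∘ splitAt (suc m))
    ≡⟨ count-suc (p ∘ splitAt (suc m)) ⟩
  indicator (p (inj₁ zero)) + count (p ∘ map₁ suc ∘ splitAt m)
    ≡⟨ cong (indicator (p (inj₁ zero)) +_) (count-splitAt m (p ∘ map₁ suc)) ⟩
  indicator (p (inj₁ zero)) + (count (p ∘ inj₁ ∘ suc) + count (p ∘ inj₂))
    ≡⟨ +-assoc (indicator (p (inj₁ zero))) _ _ ⟨
  indicator (p (inj₁ zero)) + count (p ∘ inj₁ ∘ suc) + count (p ∘ inj₂)
    ≡⟨ cong (_+ count (p ∘ inj₂)) (count-suc (p ∘ inj₁)) ⟨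
  count (p ∘ inj₁) + count (p ∘ inj₂)
    ∎
  where open ≡-Reasoning

degProduct : (D : Digraph) → Fin (n D) → ℕ
degProduct D v = outdeg D v * indeg D v

-- Δ̃(D) ≤ k; CeilMaxDeg D k unfolds to DegreeBound D k × (∀ j → DegreeBound D j → k ≤ j).
DegreeBound : Digraph → ℕ → Set
DegreeBound D k = ∀ v → degProduct D v ≤ k * k

CycleIn-map : ∀ {D E : Digraph} {A : Pred (Fin (n D)) 0ℓ} {B : Pred (Fin (n E)) 0ℓ}
  (h : Fin (n D) → Fin (n E)) → Injective _≡_ _≡_ h → (∀ {u} → A u → B (h u)) →
  (∀ {u w} → A u → A w → arc D u w ≡ true → arc E (h u) (h w) ≡ true) →
  CycleIn D A → CycleIn E B
CycleIn-map h h-inj A⇒B arc⇒arc (l , f , f-inj , f∈A , steps , closing) =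
  l , h ∘ f , f-inj ∘ h-inj , A⇒B ∘ f∈A ,
  (λ i → arc⇒arc (f∈A _) (f∈A _) (steps i)) , arc⇒arc (f∈A _) (f∈A _) closing

CycleIn-⊆ : ∀ {D : Digraph} {A B : Pred (Fin (n D)) 0ℓ} → A ⊆ B → CycleIn D A → CycleIn D B
CycleIn-⊆ {D} A⊆B = CycleIn-map {D} {D} id id (λ {u} → A⊆B {u}) (λ _ _ a → a)

inject₁≢suc : ∀ {m} (i : Fin m) → inject₁ i ≢ suc i
inject₁≢suc zero    ()
inject₁≢suc (suc i) eq = inject₁≢suc i (suc-injective eq)

inject₁-or-fromℕ : ∀ {m} (i : Fin (suc m)) → (∃ λ j → inject₁ j ≡ i) ⊎ fromℕ m ≡ i
inject₁-or-fromℕ {zero}  zero    = inj₂ refl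
inject₁-or-fromℕ {suc m} zero    = inj₁ (zero , refl)
inject₁-or-fromℕ {suc m} (suc i) with inject₁-or-fromℕ i
... | inj₁ (j , refl) = inj₁ (suc j , refl)
... | inj₂ refl       = inj₂ refl

module _ {D : Digraph} {l} {f : Fin (suc (suc l)) → Fin (n D)}
         (steps : ∀ i → arc D (f (inject₁ i)) (f (suc i)) ≡ true)
         (closing : arc D (f (fromℕ (suc l))) (f zero) ≡ true) where

  closedWalk-successor : ∀ i → ∃ λ j → j ≢ i × arc D (f i) (f j) ≡ true
  closedWalk-successor i with inject₁-or-fromℕ i
  ... | inj₁ (j , refl) = suc j , inject₁≢suc j ∘ sym , steps j
  ... | inj₂ refl       = zero , (λ ()) , closing

  closedWalk-predecessor : ∀ i → ∃ λ j → j ≢ i × arc D (f j) (f i) ≡ true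
  closedWalk-predecessor zero    = fromℕ (suc l) , (λ ()) , closing
  closedWalk-predecessor (suc i) = inject₁ i , inject₁≢suc i , steps i

arc⊎ : (D E : Digraph) → Fin (n D) ⊎ Fin (n E) → Fin (n D) ⊎ Fin (n E) → Bool
arc⊎ D E (inj₁ u) (inj₁ w) = arc D u w
arc⊎ D E (inj₁ u) (inj₂ w) = false
arc⊎ D E (inj₂ u) (inj₁ w) = false
arc⊎ D E (inj₂ u) (inj₂ w) = arc E u w

arc⊎-irreflexive : ∀ D E s → arc⊎ D E s s ≡ false
arc⊎-irreflexive D E (inj₁ u) = noLoops D u
arc⊎-irreflexive D E (inj₂ u) = noLoops E u

infixr 5 _⊕_
_⊕_ : Digraph → Digraph → Digraph
D ⊕ E = record
  { n       = n D + n E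
  ; arc     = λ u w → arc⊎ D E (splitAt (n D) u) (splitAt (n D) w)
  ; noLoops = λ v → arc⊎-irreflexive D E (splitAt (n D) v)
  }

NoDigons-⊕ : ∀ {D E} → NoDigons D → NoDigons E → NoDigons (D ⊕ E)
NoDigons-⊕ {D} {E} noD noE u w = asymmetric (splitAt (n D) u) (splitAt (n D) w)
  where
  asymmetric : ∀ s t → arc⊎ D E s t ≡ true → arc⊎ D E t s ≡ false
  asymmetric (inj₁ u) (inj₁ w) = noD u w
  asymmetric (inj₁ u) (inj₂ w) ()
  asymmetric (inj₂ u) (inj₁ w) ()
  asymmetric (inj₂ u) (inj₂ w) = noE u w

arc-⊕-↑ˡ : ∀ D E u w → arc (D ⊕ E) (u ↑ˡ n E) (w ↑ˡ n E) ≡ arc D u w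
arc-⊕-↑ˡ D E u w rewrite splitAt-↑ˡ (n D) u (n E) | splitAt-↑ˡ (n D) w (n E) = refl

outdeg-⊕ : ∀ D E v → outdeg (D ⊕ E) v ≡ [ outdeg D , outdeg E ]′ (splitAt (n D) v)
outdeg-⊕ D E v =
  trans (count-splitAt (n D) (arc⊎ D E (splitAt (n D) v))) (split (splitAt (n D) v))
  where
  split : ∀ s → count (arc⊎ D E s ∘ inj₁) + count (arc⊎ D E s ∘ inj₂)
              ≡ [ outdeg D , outdeg E ]′ s
  split (inj₁ u) = trans (cong (outdeg D u +_) (count-false {n E})) (+-identityʳ (outdeg D u))
  split (inj₂ u) = cong (_+ outdeg E u) (count-false {n D})

indeg-⊕ : ∀ D E v → indeg (D ⊕ E) v ≡ [ indeg D , indeg E ]′ (splitAt (n D) v)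
indeg-⊕ D E v =
  trans (count-splitAt (n D) (λ t → arc⊎ D E t (splitAt (n D) v))) (split (splitAt (n D) v))
  where
  split : ∀ s → count (λ u → arc⊎ D E (inj₁ u) s) + count (λ u → arc⊎ D E (inj₂ u) s)
              ≡ [ indeg D , indeg E ]′ s
  split (inj₁ w) = trans (cong (indeg D w +_) (count-false {n E})) (+-identityʳ (indeg D w))
  split (inj₂ w) = cong (_+ indeg E w) (count-false {n D})

degProduct-⊕ : ∀ D E v →
  degProduct (D ⊕ E) v ≡ [ degProduct D , degProduct E ]′ (splitAt (n D) v)
degProduct-⊕ D E v =
  trans (cong₂ _*_ (outdeg-⊕ D E v) (indeg-⊕ D E v)) (distrib (splitAt (n D) v))
  where
  distrib : ∀ s → [ outdeg D , outdeg E ]′ s * [ indeg D , indeg E ]′ s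
                ≡ [ degProduct D , degProduct E ]′ s
  distrib (inj₁ _) = refl
  distrib (inj₂ _) = refl

data StarPart : Set where
  centre source sink : StarPart

starArc : StarPart → StarPart → Bool
starArc source centre = true
starArc centre sink   = true
starArc _      _      = false

leafPart : ∀ {a b} → Fin a ⊎ Fin b → StarPart
leafPart = [ const source , const sink ]′

starPart : ∀ a b → Fin (suc (a + b)) → StarPart
starPart a b zero    = centre
starPart a b (suc w) = leafPart (splitAt a w)

star : ℕ → ℕ → Digraph
star a b = record
  { n       = suc (a + b)
  ; arc     = λ u w → starArc (starPart a b u) (starPart a b w)
  ; noLoops = λ v → irreflexive (starPart a b v)
  }
  where
  irreflexive : ∀ x → starArc x x ≡ false
  irreflexive centre = refl
  irreflexive source = refl
  irreflexive sink   = refl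

NoDigons-star : ∀ a b → NoDigons (star a b)
NoDigons-star a b u w = asymmetric (starPart a b u) (starPart a b w)
  where
  asymmetric : ∀ x y → starArc x y ≡ true → starArc y x ≡ false
  asymmetric source centre _ = refl
  asymmetric centre sink   _ = refl
  asymmetric centre centre ()
  asymmetric centre source ()
  asymmetric source source ()
  asymmetric source sink   ()
  asymmetric sink   _      ()

outdeg-star-centre : ∀ a b → outdeg (star a b) zero ≡ b
outdeg-star-centre a b =
  trans (count-suc (λ w → starArc centre (starPart a b w)))
        (trans (count-splitAt a (starArc centre ∘ leafPart))
               (cong₂ _+_ (count-false {a}) (count-true {b})))

indeg-star-centre : ∀ a b → indeg (star a b) zero ≡ a
indeg-star-centre a b =
  trans (count-suc (λ u → starArc (starPart a b u) centre))
        (trans (count-splitAt a (λ x → starArc (leafPart x) centre))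
               (trans (cong₂ _+_ (count-true {a}) (count-false {b})) (+-identityʳ a)))

outdeg-star-sink : ∀ a b {v} → starPart a b v ≡ sink → outdeg (star a b) v ≡ 0
outdeg-star-sink a b v≡sink =
  trans (count-cong (λ u → cong (λ x → starArc x (starPart a b u)) v≡sink))
        (count-false {suc (a + b)})

indeg-star-source : ∀ a b {v} → starPart a b v ≡ source → indeg (star a b) v ≡ 0
indeg-star-source a b v≡source =
  trans (count-cong (λ u → trans (cong (starArc (starPart a b u)) v≡source)
                                 (into-source (starPart a b u))))
        (count-false {suc (a + b)})
  where
  into-source : ∀ x → starArc x source ≡ false
  into-source centre = refl
  into-source source = refl
  into-source sink   = refl

degProduct-star-leaf : ∀ a b w → degProduct (star a b) (suc w) ≡ 0
degProduct-star-leaf a b w = leaf (splitAt a w) refl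
  where
  leaf : ∀ s → splitAt a w ≡ s → degProduct (star a b) (suc w) ≡ 0
  leaf (inj₁ _) eq = trans (cong (outdeg (star a b) (suc w) *_)
                                 (indeg-star-source a b (cong leafPart eq)))
                           (*-zeroʳ (outdeg (star a b) (suc w)))
  leaf (inj₂ _) eq = cong (_* indeg (star a b) (suc w)) (outdeg-star-sink a b (cong leafPart eq))

CeilMaxDeg-star : ∀ r → CeilMaxDeg (star r r) r
CeilMaxDeg-star r =
  bounded , λ j bound → m*m≤n*n⇒m≤n (subst (_≤ j * j) centre-product (bound zero))
  where
  centre-product : degProduct (star r r) zero ≡ r * r
  centre-product = cong₂ _*_ (outdeg-star-centre r r) (indeg-star-centre r r)
  bounded : DegreeBound (star r r) r
  bounded zero    = ≤-reflexive centre-product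
  bounded (suc w) = subst (_≤ r * r) (sym (degProduct-star-leaf r r w)) z≤n

-- Plays the role of D - S; keeping the vertices of S (isolated) keeps the vertex type fixed.
isolate : (D : Digraph) → (Fin (n D) → Bool) → Digraph
isolate D S = record
  { n       = n D
  ; arc     = λ u w → not (S u) ∧ not (S w) ∧ arc D u w
  ; noLoops = irreflexive
  }
  where
  irreflexive : ∀ v → not (S v) ∧ not (S v) ∧ arc D v v ≡ false
  irreflexive v with S v
  ... | true  = refl
  ... | false = noLoops D v

module _ (D : Digraph) (S : Fin (n D) → Bool) where

  isolate-arc⇒arc : ∀ u w → arc (isolate D S) u w ≡ true → arc D u w ≡ true
  isolate-arc⇒arc u w with S u | S w
  ... | false | false = id
  ... | false | true  = λ ()
  ... | true  | _     = λ ()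

  isolate-arc : ∀ {u w} → ¬ T (S u) → ¬ T (S w) → arc (isolate D S) u w ≡ arc D u w
  isolate-arc {u} {w} u∉S w∉S with S u | S w
  ... | false | false = refl
  ... | false | true  = ⊥-elim (w∉S _)
  ... | true  | _     = ⊥-elim (u∉S _)

  isolate-arc-from : ∀ {u} w → T (S u) → arc (isolate D S) u w ≡ false
  isolate-arc-from {u} w u∈S with S u
  ... | true = refl

  isolate-arc-into : ∀ u {w} → T (S w) → arc (isolate D S) u w ≡ false
  isolate-arc-into u {w} w∈S with S u | S w
  ... | true  | _    = refl
  ... | false | true = refl

  NoDigons-isolate : NoDigons D → NoDigons (isolate D S)
  NoDigons-isolate noD u w with S u | S w
  ... | false | false = noD u w
  ... | false | true  = λ ()
  ... | true  | _     = λ ()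

  outdeg-isolate-∈ : ∀ {v} → T (S v) → outdeg (isolate D S) v ≡ 0
  outdeg-isolate-∈ v∈S = trans (count-cong (λ w → isolate-arc-from w v∈S)) (count-false {n D})

  outdeg-isolate-< : ∀ {v w} → T (S w) → arc D v w ≡ true → outdeg (isolate D S) v < outdeg D v
  outdeg-isolate-< {v} w∈S v→w =
    count-mono-< (isolate-arc⇒arc v) (isolate-arc-into v w∈S) v→w

  indeg-isolate-< : ∀ {v w} → T (S w) → arc D w v ≡ true → indeg (isolate D S) v < indeg D v
  indeg-isolate-< {v} w∈S w→v =
    count-mono-< (λ u → isolate-arc⇒arc u v) (isolate-arc-from v w∈S) w→v

insert : ∀ {m} → (Fin m → Bool) → Fin m → Fin m → Bool
insert S v u = ⌊ v ≟ u ⌋ ∨ S u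

insert-⊆ : ∀ {m} (S : Fin m → Bool) v → T ∘ insert S v ⊆ T ∘ S ∪ ｛ v ｝
insert-⊆ S v = swap ∘ map₁ toWitness ∘ Equivalence.to T-∨

insert-⊇ : ∀ {m} (S : Fin m → Bool) v → T ∘ S ∪ ｛ v ｝ ⊆ T ∘ insert S v
insert-⊇ S v = Equivalence.from T-∨ ∘ map₁ fromWitness ∘ swap

MaximalAcyclic : (D : Digraph) → (Fin (n D) → Bool) → Set
MaximalAcyclic D S = Acyclic D (T ∘ S) × (∀ v → ¬ T (S v) → CycleIn D (T ∘ S ∪ ｛ v ｝))

¬¬-maximalAcyclicOn : ∀ D (L : List (Fin (n D))) → ¬ ¬ (Σ (Fin (n D) → Bool) λ S →
  Acyclic D (T ∘ S) × (∀ v → v ∈ L → ¬ T (S v) → CycleIn D (T ∘ S ∪ ｛ v ｝)))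
¬¬-maximalAcyclicOn D []      =
  pure (const false , (λ (_ , _ , _ , f∈∅ , _) → f∈∅ zero) , λ _ ())
¬¬-maximalAcyclicOn D (v ∷ L) = do
  (S , acyclic , maximal) ← ¬¬-maximalAcyclicOn D L
  yes cycle ← ¬¬-excluded-middle {A = CycleIn D (T ∘ S ∪ ｛ v ｝)}
    where no noCycle → pure ( insert S v
                            , noCycle ∘ CycleIn-⊆ {D} {T ∘ insert S v} (insert-⊆ S v)
                            , maximal′ maximal)
  pure (S , acyclic , λ { _ (here refl) _ → cycle ; u (there u∈L) → maximal u u∈L })
  where
  maximal′ : ∀ {S} → (∀ u → u ∈ L → ¬ T (S u) → CycleIn D (T ∘ S ∪ ｛ u ｝)) →
    ∀ u → u ∈ v ∷ L → ¬ T (insert S v u) → CycleIn D (T ∘ insert S v ∪ ｛ u ｝)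
  maximal′ {S} _       _ (here refl) v∉S′ = ⊥-elim (v∉S′ (insert-⊇ S v (inj₂ refl)))
  maximal′ {S} maximal u (there u∈L) u∉S′ =
    CycleIn-⊆ {D} {T ∘ S ∪ ｛ u ｝} (map₁ (insert-⊇ S v ∘ inj₁))
      (maximal u u∈L (u∉S′ ∘ insert-⊇ S v ∘ inj₁))

¬¬-maximalAcyclic : ∀ D → ¬ ¬ (Σ (Fin (n D) → Bool) (MaximalAcyclic D))
¬¬-maximalAcyclic D = do
  (S , acyclic , maximal) ← ¬¬-maximalAcyclicOn D (allFin (n D))
  pure (S , acyclic , λ v → maximal v (∈-allFin v))

-- A cycle of D[S ∪ {v}] must pass through v, and its neighbours on the cycle lie in S.
cycle-through : ∀ {D S v} → Acyclic D (T ∘ S) → CycleIn D (T ∘ S ∪ ｛ v ｝) →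
  (∃ λ w → T (S w) × arc D v w ≡ true) × (∃ λ w → T (S w) × arc D w v ≡ true)
cycle-through {D} {S} {v} acyclic (l , f , f-inj , f∈ , walk@(steps , closing))
  with any? (λ i → v ≟ f i)
... | no v∉f =
  ⊥-elim (acyclic (l , f , f-inj , (λ i → [ id , ⊥-elim ∘ v∉f ∘ (i ,_) ]′ (f∈ i)) , walk))
... | yes (i , refl) = onCycle (closedWalk-successor {D} {f = f} steps closing i) ,
                       onCycle (closedWalk-predecessor {D} {f = f} steps closing i)
  where
  onCycle : ∀ {P : Pred (Fin (n D)) 0ℓ} → (∃ λ j → j ≢ i × P (f j)) → ∃ λ w → T (S w) × P w
  onCycle (j , j≢i , p) =
    f j , [ id , (λ fi≡fj → ⊥-elim (j≢i (f-inj (sym fi≡fj)))) ]′ (f∈ j) , p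

Acyclic-singleton : ∀ D i → Acyclic D (λ v → v ≡ i)
Acyclic-singleton D i (_ , f , f-inj , f≡i , _) =
  0≢1+n (f-inj (trans (f≡i zero) (sym (f≡i (suc zero)))))

Minimum : (ℕ → Set) → Set
Minimum P = Σ ℕ λ j → P j × (∀ i → P i → j ≤ i)

¬¬-minimum : ∀ (P : ℕ → Set) {m} → P m → ¬ ¬ Minimum P
¬¬-minimum P {m} = <-rec (λ m → P m → ¬ ¬ Minimum P) least m
  where
  least : ∀ m → (∀ {i} → i < m → P i → ¬ ¬ Minimum P) → P m → ¬ ¬ Minimum P
  least m below pm = do
    yes (i , i<m , pi) ← ¬¬-excluded-middle {A = Σ ℕ λ i → i < m × P i}
      where no none → pure (m , pm , λ i pi → ≮⇒≥ λ i<m → none (i , i<m , pi))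
    below i<m pi

¬¬-dichromatic : ∀ D → ¬ ¬ (Σ ℕ (IsDichromatic D))
¬¬-dichromatic D = ¬¬-minimum (AcyclicColouring D) (id , Acyclic-singleton D)

AcyclicColouring-⊕ˡ : ∀ {D E k} → AcyclicColouring (D ⊕ E) k → AcyclicColouring D k
AcyclicColouring-⊕ˡ {D} {E} (c , acyclic) = c ∘ (_↑ˡ n E) , λ i →
  acyclic i ∘ CycleIn-map {D} {D ⊕ E} {λ v → c (v ↑ˡ n E) ≡ i} {λ v → c v ≡ i}
                (_↑ˡ n E) (↑ˡ-injective (n E) _ _) id
                (λ {u} {w} _ _ → trans (arc-⊕-↑ˡ D E u w))

-- S becomes colour zero; the other colour classes do not meet S, where D and isolate D S agree.
AcyclicColouring-isolate : ∀ {D S k} → Acyclic D (T ∘ S) →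
  AcyclicColouring (isolate D S) k → AcyclicColouring D (suc k)
AcyclicColouring-isolate {D} {S} {k} S-acyclic (c , acyclic) = colour , classes
  where
  colour : Fin (n D) → Fin (suc k)
  colour v = if S v then zero else suc (c v)
  zero-class : ∀ {u} → colour u ≡ zero → T (S u)
  zero-class {u} with S u
  ... | true = _
  suc-class : ∀ {i u} → colour u ≡ suc i → ¬ T (S u) × c u ≡ i
  suc-class {u = u} with S u
  ... | false = λ { refl → id , refl }
  classes : ∀ i → Acyclic D (λ v → colour v ≡ i)
  classes zero = S-acyclic ∘ CycleIn-⊆ {D} {λ v → colour v ≡ zero} {T ∘ S} zero-class
  classes (suc i) =
    acyclic i ∘ CycleIn-map {D} {isolate D S} {λ v → colour v ≡ suc i} {λ v → c v ≡ i}
                  id id (proj₂ ∘ suc-class)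
                  (λ u∈ w∈ → trans (isolate-arc D S (proj₁ (suc-class u∈)) (proj₁ (suc-class w∈))))

DegreeBound-isolate : ∀ {D S r} → MaximalAcyclic D S → DegreeBound D (suc r) →
  DegreeBound (isolate D S) r
DegreeBound-isolate {D} {S} {r} (S-acyclic , maximal) bound v with T? (S v)
... | yes v∈S rewrite outdeg-isolate-∈ D S v∈S = z≤n
... | no  v∉S with cycle-through {D} {S} S-acyclic (maximal v v∉S)
...   | (_ , w∈S , v→w) , (_ , w′∈S , w′→v) =
  [1+m]*[1+n]≤[1+r]*[1+r]⇒m*n≤r*r (outdeg (isolate D S) v) (indeg (isolate D S) v) r
    (≤-trans (*-mono-≤ (outdeg-isolate-< D S w∈S v→w) (indeg-isolate-< D S w′∈S w′→v))
             (bound v))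

CeilMaxDeg-⊕ : ∀ {D E k} → DegreeBound D k → CeilMaxDeg E k → CeilMaxDeg (D ⊕ E) k
CeilMaxDeg-⊕ {D} {E} {k} boundD (boundE , leastE) =
  bounded , λ j bound → leastE j λ u → subst (_≤ j * j) (degProduct-⊕-↑ʳ u) (bound (n D ↑ʳ u))
  where
  degProduct-⊕-↑ʳ : ∀ u → degProduct (D ⊕ E) (n D ↑ʳ u) ≡ degProduct E u
  degProduct-⊕-↑ʳ u = trans (degProduct-⊕ D E (n D ↑ʳ u))
                            (cong [ degProduct D , degProduct E ]′ (splitAt-↑ʳ (n D) (n E) u))
  bounded-on : ∀ s → [ degProduct D , degProduct E ]′ s ≤ k * k
  bounded-on (inj₁ u) = boundD u
  bounded-on (inj₂ u) = boundE u
  bounded : DegreeBound (D ⊕ E) k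
  bounded v = subst (_≤ k * k) (sym (degProduct-⊕ D E v)) (bounded-on (splitAt (n D) v))

-- The choices of a maximal acyclic set and of χ of the auxiliary digraph are classical;
-- they are made inside ¬ ¬, which is harmless because the goal is a decidable inequality.
GoodBound-suc : ∀ {r} → GoodBound r → GoodBound (suc r)
GoodBound-suc {r} good D noDigons ceil χ (_ , minimal) = decidable-stable (suc χ ≤? suc r) do
  (S , S-maximal) ← ¬¬-maximalAcyclic D
  let D′ = isolate D S ⊕ star r r
      D′-noDigons = NoDigons-⊕ (NoDigons-isolate D S noDigons) (NoDigons-star r r)
      D′-ceil = CeilMaxDeg-⊕ (DegreeBound-isolate {D} {S} {r} S-maximal (proj₁ ceil))
                             (CeilMaxDeg-star r)
  (χ′ , colouring′ , minimal′) ← ¬¬-dichromatic D′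
  let colouring = AcyclicColouring-isolate {D} {S} (proj₁ S-maximal)
                                           (AcyclicColouring-⊕ˡ colouring′)
  pure (s≤s (≤-trans (minimal (suc χ′) colouring)
                     (good D′ D′-noDigons D′-ceil χ′ (colouring′ , minimal′))))

GoodBound-mono : ∀ {m n} → m ≤′ n → GoodBound m → GoodBound n
GoodBound-mono ≤′-refl        good = good
GoodBound-mono (≤′-step m≤′n) good = GoodBound-suc (GoodBound-mono m≤′n good)

proposition1 : ∀ (Δ₀ : ℕ) → GoodBound Δ₀ → (∀ m → m < Δ₀ → ¬ GoodBound m) →
    ∀ (D : Digraph) → NoDigons D → ∀ k → CeilMaxDeg D k → Δ₀ ≤ k →
    ∀ χ → IsDichromatic D χ → suc χ ≤ k
proposition1 Δ₀ good _ D noDigons k ceil Δ₀≤k =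
  GoodBound-mono (≤⇒≤′ Δ₀≤k) good D noDigons ceil
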